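{- Let $G=(V,E,w)$ be a finite simple undirected graph with positive vertex weights containing a $6$-cycle $v_1v_2v_3v_4v_5v_6$ (edges $v_1v_2,v_2v_3,v_3v_4,v_4v_5,v_5v_6,v_6v_1$) such that $d_G(v_2)=d_G(v_3)=d_G(v_5)=d_G(v_6)=2$, $w(v_1)\ge\max\{w(v_2),w(v_6)\}$, $w(v_4)\ge\max\{w(v_3),w(v_5)\}$, and $w(v_6)\ge w(v_5)$. (1) If $w(v_2)\ge w(v_3)$, let $G'$ be obtained from $G$ by deleting $v_5$ and $v_6$ and changing the weight of $v_2$ to $w(v_2)+w(v_6)$ and the weight of $v_3$ to $w(v_3)+w(v_5)$. (2) If $w(v_2)<w(v_3)$, let $G'$ be obtained from $G$ by deleting $v_6$, adding the edge $v_1v_5$, and changing the weight of $v_2$ to $w(v_2)+w(v_6)$, the weight of $v_3$ to $w(v_3)+w(v_5)$, and the weight of $v_5$ to $w(v_6)+w(v_3)-\max\{w(v_2)+w(v_6),\,w(v_3)+w(v_5)\}$. In either case (all other weights unchanged), $\alpha(G)=\alpha(G')$.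
   Context: $\alpha(H)$ denotes the maximum total vertex weight of an independent set in the weighted graph $H$; $d_G(v)$ is the degree of $v$ in $G$. All weights on the right-hand sides of the update rules refer to the weights in $G$.
   Formalization: The vertex weights w take values in the positive rationals. -}

module Defs where

open import Data.Nat using (ℕ; zero; suc)
open import Data.Bool using (Bool; true; false; _∧_; _∨_; not; if_then_else_)
open import Data.Fin using (Fin; _≟_)
open import Data.Fin.Subset using (Subset)
open import Data.Vec using (Vec; []; _∷_; lookup)
open import Data.List using (List; []; _∷_; map; filter; foldr; length; allFin; _++_)
open import Data.Rational using (ℚ; 0ℚ; _+_; _⊔_)
open import Relation.Nullary.Decidable using (⌊_⌋)
open import Relation.Binary.PropositionalEquality using (_≡_)
open import Data.Empty using (⊥)

record SimpleGraph (n : ℕ) : Set where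
  field
    adj       : Fin n → Fin n → Bool
    adj-sym   : ∀ i j → adj i j ≡ adj j i
    adj-irrefl : ∀ i → adj i i ≡ false
open SimpleGraph public

degree : ∀ {n} → (Fin n → Fin n → Bool) → Fin n → ℕ
degree {n} a v = length (filter (λ u → a v u Data.Bool.≟ true) (allFin n))

allB : ∀ {A : Set} → (A → Bool) → List A → Bool
allB p = foldr (λ x b → p x ∧ b) true

allSubsets : (n : ℕ) → List (Subset n)
allSubsets zero    = [] ∷ []
allSubsets (suc n) = map (false ∷_) (allSubsets n) ++ map (true ∷_) (allSubsets n)

isIndepIn : ∀ {n} → (Fin n → Fin n → Bool) → Subset n → Subset n → Bool
isIndepIn {n} a U S =
  allB (λ i → not (lookup S i) ∨ lookup U i) (allFin n)
  ∧ allB (λ i → allB (λ j → not (lookup S i ∧ lookup S j ∧ a i j)) (allFin n)) (allFin n)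

weightOf : ∀ {n} → (Fin n → ℚ) → Subset n → ℚ
weightOf {n} w S = foldr (λ i acc → (if lookup S i then w i else 0ℚ) + acc) 0ℚ (allFin n)

-- α of the weighted graph induced by (adjacency a, weights w) on vertex set U:
-- maximum total weight of an independent set contained in U
-- (the empty set is always a candidate, so 0 is the base of the max).
αOn : ∀ {n} → (Fin n → Fin n → Bool) → (Fin n → ℚ) → Subset n → ℚ
αOn {n} a w U =
  foldr _⊔_ 0ℚ (map (weightOf w) (filter (λ S → isIndepIn a U S Data.Bool.≟ true) (allSubsets n)))

fullSet : ∀ {n} → Subset n
fullSet {zero} = []
fullSet {suc n} = true ∷ fullSet

α : ∀ {n} → SimpleGraph n → (Fin n → ℚ) → ℚ
α G w = αOn (adj G) w fullSet

_∖ˡ_ : ∀ {n} → Subset n → List (Fin n) → Subset n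
U ∖ˡ [] = U
U ∖ˡ (x ∷ xs) = Data.Vec.updateAt U x (λ _ → false) ∖ˡ xs

_==_ : ∀ {n} → Fin n → Fin n → Bool
i == j = ⌊ i ≟ j ⌋

addEdge : ∀ {n} → (Fin n → Fin n → Bool) → Fin n → Fin n → (Fin n → Fin n → Bool)
addEdge a x y i j = a i j ∨ (i == x ∧ j == y) ∨ (i == y ∧ j == x)

setW : ∀ {n} → (Fin n → ℚ) → Fin n → ℚ → (Fin n → ℚ)
setW w x c i = if i == x then c else w i

{-# OPTIONS --safe #-}
-- The degree-two vertices v₂, v₃ and v₆, v₅ form two paths from v₁ to v₄ that meet the rest of
-- the graph only at v₁ and v₄, in G as well as in the reduced graph. Once it is fixed which of
-- v₁, v₄ an independent set contains, the best way to complete it on each path is determined, and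
-- replacing its part on the paths by that best part keeps it independent without lowering its
-- weight. The new weights are chosen so that, for each of the four possibilities at v₁ and v₄, the
-- best completions in G and in the reduced graph weigh the same. Hence every independent set of
-- either graph is dominated by one of the other, and the two maxima coincide.
module Submission where

open import Defs
open import Data.Fin as Fin using (Fin; _≟_)
open import Data.Bool using (Bool; true; false; _∧_; _∨_; not; if_then_else_)
import Data.Bool as Bool
open import Data.Bool.Properties using (∧-comm; ∧-zeroʳ; ∨-comm; ∨-zeroʳ)
open import Data.List using (List; []; _∷_; foldr; map; filter; length; allFin)
open import Data.List.Membership.Propositional using (_∈_; _∉_)
import Data.List.Membership.DecPropositional as DecMembership
open import Data.List.Membership.Propositional.Properties
  using (∈-allFin; ∈-map⁺; ∈-map⁻; ∈-filter⁺; ∈-filter⁻; ∈-++⁺ˡ; ∈-++⁺ʳ)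
open import Data.List.Relation.Unary.Any using (here; there)
open import Data.List.Relation.Unary.All using ([]; _∷_) renaming (lookup to All-lookup)
open import Data.List.Relation.Unary.All.Properties using (All¬⇒¬Any)
open import Data.List.Relation.Unary.AllPairs using ([]; _∷_)
open import Data.List.Relation.Unary.Unique.Propositional using (Unique)
open import Data.List.Relation.Unary.Unique.Propositional.Properties using (allFin⁺)
open import Data.Vec as Vec using (lookup; tabulate)
open import Data.Vec.Properties using (lookup∘tabulate; lookup∘updateAt; lookup∘updateAt′)
open import Data.Fin.Subset using (Subset)
open import Data.Rational using (ℚ; 0ℚ; _+_; _-_; -_; _⊔_; _≤_; _<_)
open import Data.Rational.Properties
  using (+-assoc; +-comm; +-inverseʳ; +-identityˡ; +-identityʳ; ≤-refl; ≤-trans; ≤-reflexive; ≤-antisym;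
         ≤-total; <⇒≤; +-mono-≤; +-monoˡ-≤; +-monoʳ-≤; p≤p⊔q; p≤q⊔p; ⊔-lub; p≤q⇒p⊔q≡q; p≥q⇒p⊔q≡p)
open import Data.Rational.Solver using (module +-*-Solver)
open import Data.Product using (Σ; _×_; _,_; proj₁; proj₂)
open import Data.Sum using (_⊎_; inj₁; inj₂)
open import Relation.Nullary using (Dec; yes; no; contradiction)
open import Relation.Binary.PropositionalEquality
open import Function using (id)

open +-*-Solver

ite : Bool → ℚ → ℚ
ite b x = if b then x else 0ℚ

ite-nonneg : ∀ b {x} → 0ℚ ≤ x → 0ℚ ≤ ite b x
ite-nonneg true  0≤x = 0≤x
ite-nonneg false _   = ≤-refl

ite-+ : ∀ b x y → ite b (x + y) ≡ ite b x + ite b y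
ite-+ true  x y = refl
ite-+ false x y = refl

+-cancelʳ-≤ : ∀ {x y} z → x + z ≤ y + z → x ≤ y
+-cancelʳ-≤ {x} {y} z x+z≤y+z = begin
  x           ≡⟨ solve 2 (λ x z → x := x :+ z :- z) refl x z ⟩
  x + z - z   ≤⟨ +-monoˡ-≤ (- z) x+z≤y+z ⟩
  y + z - z   ≡⟨ solve 2 (λ y z → y :+ z :- z := y) refl y z ⟩
  y           ∎
  where open Data.Rational.Properties.≤-Reasoning

==-refl : ∀ {n} (x : Fin n) → x == x ≡ true
==-refl x with x ≟ x
... | yes _  = refl
... | no x≢x = contradiction refl x≢x

==⇒≡ : ∀ {n} {i x : Fin n} → i == x ≡ true → i ≡ x
==⇒≡ {i = i} {x} i==x with i ≟ x
... | yes i≡x = i≡x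

update : ∀ {n} {A : Set} → (Fin n → A) → Fin n → A → Fin n → A
update f x c i = if i == x then c else f i

update-same : ∀ {n} {A : Set} (f : Fin n → A) x c → update f x c x ≡ c
update-same f x c rewrite ==-refl x = refl

update-other : ∀ {n} {A : Set} (f : Fin n → A) {x} c {i} → i ≢ x → update f x c i ≡ f i
update-other f {x} c {i} i≢x with i ≟ x
... | yes i≡x = contradiction i≡x i≢x
... | no _    = refl

∑ : ∀ {A : Set} → (A → ℚ) → List A → ℚ
∑ f = foldr (λ x acc → f x + acc) 0ℚ

∑-cong : ∀ {A : Set} {f g : A → ℚ} xs → (∀ x → x ∈ xs → f x ≡ g x) → ∑ f xs ≡ ∑ g xs
∑-cong []       _  = refl
∑-cong (x ∷ xs) eq = cong₂ _+_ (eq x (here refl)) (∑-cong xs (λ y y∈xs → eq y (there y∈xs)))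

∑-exchange-one : ∀ {n} {f g : Fin n → ℚ} {x} {ys} → Unique ys → x ∈ ys →
                 (∀ i → i ≢ x → f i ≡ g i) → ∑ f ys + g x ≡ ∑ g ys + f x
∑-exchange-one {f = f} {g} {x} {_ ∷ ys} (x∉ys ∷ _) (here refl) agree =
  begin
    (f x + ∑ f ys) + g x  ≡⟨ cong (λ s → (f x + s) + g x) (∑-cong ys off-x) ⟩
    (f x + ∑ g ys) + g x  ≡⟨ solve 3 (λ a b c → (a :+ b) :+ c := (c :+ b) :+ a) refl (f x) (∑ g ys) (g x) ⟩
    (g x + ∑ g ys) + f x  ∎
  where
    open ≡-Reasoning
    off-x : ∀ i → i ∈ ys → f i ≡ g i
    off-x i i∈ys = agree i (≢-sym (All-lookup x∉ys i∈ys))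
∑-exchange-one {f = f} {g} {x} {y ∷ ys} (y∉ys ∷ uniq) (there x∈ys) agree =
  begin
    (f y + ∑ f ys) + g x  ≡⟨ +-assoc (f y) _ _ ⟩
    f y + (∑ f ys + g x)  ≡⟨ cong₂ _+_ (agree y (All-lookup y∉ys x∈ys)) (∑-exchange-one uniq x∈ys agree) ⟩
    g y + (∑ g ys + f x)  ≡⟨ sym (+-assoc (g y) _ _) ⟩
    (g y + ∑ g ys) + f x  ∎
  where open ≡-Reasoning

∑-allFin-exchange : ∀ {n} {f g : Fin n → ℚ} {xs} → Unique xs → (∀ i → i ∉ xs → f i ≡ g i) →
                    ∑ f (allFin n) + ∑ g xs ≡ ∑ g (allFin n) + ∑ f xs
∑-allFin-exchange {n} {f} {g} {[]} _ agree =
  cong (_+ 0ℚ) (∑-cong (allFin n) (λ i _ → agree i (λ ())))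
∑-allFin-exchange {n} {f} {g} {x ∷ xs} (x∉xs ∷ uniq) agree =
  begin
    Σf + (g x + ∑ g xs)     ≡⟨ sym (+-assoc Σf _ _) ⟩
    (Σf + g x) + ∑ g xs     ≡⟨ cong (_+ ∑ g xs) step-x ⟩
    (Σh + f x) + ∑ g xs     ≡⟨ solve 3 (λ a b c → (a :+ b) :+ c := (a :+ c) :+ b) refl Σh (f x) (∑ g xs) ⟩
    (Σh + ∑ g xs) + f x     ≡⟨ cong (_+ f x) (∑-allFin-exchange uniq h≡g) ⟩
    (Σg + ∑ h xs) + f x     ≡⟨ cong (λ s → (Σg + s) + f x) (∑-cong xs h≡f) ⟩
    (Σg + ∑ f xs) + f x     ≡⟨ solve 3 (λ a b c → (a :+ b) :+ c := a :+ (c :+ b)) refl Σg (∑ f xs) (f x) ⟩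
    Σg + (f x + ∑ f xs)     ∎
  where
    open ≡-Reasoning
    h : Fin n → ℚ
    h = update f x (g x)
    Σf Σg Σh : ℚ
    Σf = ∑ f (allFin n)
    Σg = ∑ g (allFin n)
    Σh = ∑ h (allFin n)
    step-x : Σf + g x ≡ Σh + f x
    step-x = subst (λ c → Σf + c ≡ Σh + f x) (update-same f x (g x))
               (∑-exchange-one (allFin⁺ n) (∈-allFin x) (λ i i≢x → sym (update-other f (g x) i≢x)))
    h≡f : ∀ i → i ∈ xs → h i ≡ f i
    h≡f i i∈xs = update-other f (g x) (≢-sym (All-lookup x∉xs i∈xs))
    h≡g : ∀ i → i ∉ xs → h i ≡ g i
    h≡g i i∉xs with i ≟ x
    ... | yes refl = refl
    ... | no i≢x  = agree i λ { (here i≡x) → i≢x i≡x ; (there i∈xs) → i∉xs i∈xs }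

weightOn : ∀ {n} → (Fin n → ℚ) → (Fin n → Bool) → List (Fin n) → ℚ
weightOn w s = ∑ (λ i → ite (s i) (w i))

weight : ∀ {n} → (Fin n → ℚ) → (Fin n → Bool) → ℚ
weight {n} w s = weightOn w s (allFin n)

weight-≤-of-local : ∀ {n} {w v : Fin n → ℚ} {s t : Fin n → Bool} {xs} → Unique xs →
                    (∀ i → i ∉ xs → t i ≡ s i) → (∀ i → i ∉ xs → v i ≡ w i) →
                    weightOn w s xs ≤ weightOn v t xs → weight w s ≤ weight v t
weight-≤-of-local {w = w} {v} {s} {t} {xs} uniq t≡s v≡w local≤ =
  +-cancelʳ-≤ (weightOn v t xs) (begin
    weight w s + weightOn v t xs  ≡⟨ ∑-allFin-exchange uniq agree ⟩
    weight v t + weightOn w s xs  ≤⟨ +-monoʳ-≤ (weight v t) local≤ ⟩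
    weight v t + weightOn v t xs  ∎)
  where
    open Data.Rational.Properties.≤-Reasoning
    agree : ∀ i → i ∉ xs → ite (s i) (w i) ≡ ite (t i) (v i)
    agree i i∉xs = sym (cong₂ ite (t≡s i i∉xs) (v≡w i i∉xs))

-- Independent sets and α

record Independent {n} (a : Fin n → Fin n → Bool) (u s : Fin n → Bool) : Set where
  field
    within  : ∀ i → s i ≡ true → u i ≡ true
    no-edge : ∀ i j → a i j ≡ true → s i ∧ s j ≡ false

open Independent

Independent-cong : ∀ {n} {a : Fin n → Fin n → Bool} {u s t} → (∀ i → s i ≡ t i) →
                   Independent a u s → Independent a u t
Independent-cong s≗t I .within i tᵢ = I .within i (trans (s≗t i) tᵢ)
Independent-cong s≗t I .no-edge i j aᵢⱼ = subst₂ (λ p q → p ∧ q ≡ false) (s≗t i) (s≗t j) (I .no-edge i j aᵢⱼ)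

Independent-absent : ∀ {n} {a : Fin n → Fin n → Bool} {u s} → Independent a u s → ∀ x → u x ≡ false → s x ≡ false
Independent-absent {s = s} I x uₓ with s x in sₓ
... | false = refl
... | true  with () ← trans (sym uₓ) (I .within x sₓ)

allB-true⁻ : ∀ {A : Set} (p : A → Bool) {xs x} → allB p xs ≡ true → x ∈ xs → p x ≡ true
allB-true⁻ p {y ∷ _} all (here refl) with p y
... | true = refl
allB-true⁻ p {y ∷ _} all (there x∈xs) with p y
... | true = allB-true⁻ p all x∈xs

allB-true⁺ : ∀ {A : Set} (p : A → Bool) xs → (∀ x → p x ≡ true) → allB p xs ≡ true
allB-true⁺ p []       _     = refl
allB-true⁺ p (x ∷ xs) all-p rewrite all-p x = allB-true⁺ p xs all-p

∧-true : ∀ {x y} → x ∧ y ≡ true → x ≡ true × y ≡ true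
∧-true {true} {true} _ = refl , refl

implication⁻ : ∀ {x y} → not x ∨ y ≡ true → x ≡ true → y ≡ true
implication⁻ {true} y≡true _ = y≡true

implication⁺ : ∀ x {y} → (x ≡ true → y ≡ true) → not x ∨ y ≡ true
implication⁺ false _   = refl
implication⁺ true  x⇒y = x⇒y refl

nand⁻ : ∀ x y {z} → not (x ∧ y ∧ z) ≡ true → z ≡ true → x ∧ y ≡ false
nand⁻ false _              _  _ = refl
nand⁻ true  false          _  _ = refl
nand⁻ true  true  {true}   () _

nand⁺ : ∀ x y {z} → (z ≡ true → x ∧ y ≡ false) → not (x ∧ y ∧ z) ≡ true
nand⁺ false _     _ = refl
nand⁺ true  false _ = refl
nand⁺ true  true {false} _ = refl
nand⁺ true  true {true}  z⇒ with () ← z⇒ refl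

isIndepIn⇒Independent : ∀ {n} (a : Fin n → Fin n → Bool) U S →
                        isIndepIn a U S ≡ true → Independent a (lookup U) (lookup S)
isIndepIn⇒Independent {n} a U S indep = record
  { within  = λ i → implication⁻ (allB-true⁻ inside (proj₁ both) (∈-allFin i))
  ; no-edge = λ i j → nand⁻ (lookup S i) (lookup S j)
                         (allB-true⁻ (edge-free i) (allB-true⁻ _ (proj₂ both) (∈-allFin i)) (∈-allFin j))
  }
  where
    inside : Fin n → Bool
    inside i = not (lookup S i) ∨ lookup U i
    edge-free : Fin n → Fin n → Bool
    edge-free i j = not (lookup S i ∧ lookup S j ∧ a i j)
    both : allB inside (allFin n) ≡ true × allB (λ i → allB (edge-free i) (allFin n)) (allFin n) ≡ true
    both = ∧-true indep

Independent⇒isIndepIn : ∀ {n} (a : Fin n → Fin n → Bool) U S →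
                        Independent a (lookup U) (lookup S) → isIndepIn a U S ≡ true
Independent⇒isIndepIn {n} a U S I
  rewrite allB-true⁺ _ (allFin n) (λ i → implication⁺ (lookup S i) (I .within i)) =
  allB-true⁺ _ (allFin n) λ i → allB-true⁺ _ (allFin n) λ j → nand⁺ (lookup S i) (lookup S j) (I .no-edge i j)

⊔-fold-upper : ∀ {x} xs → x ∈ xs → x ≤ foldr _⊔_ 0ℚ xs
⊔-fold-upper (x ∷ xs) (here refl)  = p≤p⊔q x _
⊔-fold-upper (y ∷ xs) (there x∈xs) = ≤-trans (⊔-fold-upper xs x∈xs) (p≤q⊔p y _)

⊔-fold-nonneg : ∀ xs → 0ℚ ≤ foldr _⊔_ 0ℚ xs
⊔-fold-nonneg []       = ≤-refl
⊔-fold-nonneg (x ∷ xs) = ≤-trans (⊔-fold-nonneg xs) (p≤q⊔p x _)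

⊔-fold-least : ∀ {m} xs → 0ℚ ≤ m → (∀ x → x ∈ xs → x ≤ m) → foldr _⊔_ 0ℚ xs ≤ m
⊔-fold-least []       0≤m _     = 0≤m
⊔-fold-least (x ∷ xs) 0≤m bound = ⊔-lub (bound x (here refl)) (⊔-fold-least xs 0≤m (λ y y∈xs → bound y (there y∈xs)))

allSubsets-complete : ∀ {n} (S : Subset n) → S ∈ allSubsets n
allSubsets-complete Vec.[]          = here refl
allSubsets-complete (false Vec.∷ S) = ∈-++⁺ˡ (∈-map⁺ (false Vec.∷_) (allSubsets-complete S))
allSubsets-complete (true Vec.∷ S)  = ∈-++⁺ʳ _ (∈-map⁺ (true Vec.∷_) (allSubsets-complete S))

weight≤αOn : ∀ {n} (a : Fin n → Fin n → Bool) (w : Fin n → ℚ) U {s} →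
             Independent a (lookup U) s → weight w s ≤ αOn a w U
weight≤αOn {n} a w U {s} I = begin
  weight w s         ≡⟨ ∑-cong (allFin n) (λ i _ → cong (λ b → ite b (w i)) (sym (lookup∘tabulate s i))) ⟩
  weightOf w S       ≤⟨ ⊔-fold-upper _ (∈-map⁺ (weightOf w) (∈-filter⁺ _ (allSubsets-complete S) S-indep)) ⟩
  αOn a w U          ∎
  where
    open Data.Rational.Properties.≤-Reasoning
    S : Subset n
    S = tabulate s
    S-indep : isIndepIn a U S ≡ true
    S-indep = Independent⇒isIndepIn a U S (Independent-cong (λ i → sym (lookup∘tabulate s i)) I)

αOn≤ : ∀ {n} (a : Fin n → Fin n → Bool) (w : Fin n → ℚ) U {m} → 0ℚ ≤ m →
       (∀ s → Independent a (lookup U) s → weight w s ≤ m) → αOn a w U ≤ m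
αOn≤ {n} a w U {m} 0≤m bound = ⊔-fold-least _ 0≤m weights≤m
  where
    independent? : (S : Subset n) → Dec (isIndepIn a U S ≡ true)
    independent? S = isIndepIn a U S Bool.≟ true
    weights≤m : ∀ x → x ∈ map (weightOf w) (filter independent? (allSubsets n)) → x ≤ m
    weights≤m x x∈ with S , S∈ , refl ← ∈-map⁻ (weightOf w) x∈ =
      bound (lookup S) (isIndepIn⇒Independent a U S (proj₂ (∈-filter⁻ independent? {xs = allSubsets n} S∈)))

αOn-nonneg : ∀ {n} (a : Fin n → Fin n → Bool) (w : Fin n → ℚ) U → 0ℚ ≤ αOn a w U
αOn-nonneg {n} a w U = ⊔-fold-nonneg (map (weightOf w) (filter (λ S → isIndepIn a U S Bool.≟ true) (allSubsets n)))

αOn-mono : ∀ {n} {a a′ : Fin n → Fin n → Bool} {w w′ : Fin n → ℚ} U U′ →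
           (∀ s → Independent a (lookup U) s →
              Σ (Fin n → Bool) λ t → Independent a′ (lookup U′) t × weight w s ≤ weight w′ t) →
           αOn a w U ≤ αOn a′ w′ U′
αOn-mono {a = a} {a′} {w} {w′} U U′ dominated = αOn≤ a w U (αOn-nonneg a′ w′ U′) bound
  where
    bound : ∀ s → Independent a (lookup U) s → weight w s ≤ αOn a′ w′ U′
    bound s I with t , I′ , s≤t ← dominated s I = ≤-trans s≤t (weight≤αOn a′ w′ U′ I′)

Independent-patch : ∀ {n} {aS aT : Fin n → Fin n → Bool} {uS uT s t : Fin n → Bool} (xs : List (Fin n)) →
  (∀ i j → aT i j ≡ aT j i) → Independent aS uS s →
  (∀ i → i ∉ xs → t i ≡ s i) →
  (∀ i → i ∉ xs → uS i ≡ true → uT i ≡ true) →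
  (∀ i j → i ∉ xs → j ∉ xs → aT i j ≡ true → aS i j ≡ true) →
  (∀ x → x ∈ xs → t x ≡ true → uT x ≡ true) →
  (∀ x j → x ∈ xs → aT x j ≡ true → t x ∧ t j ≡ false) →
  Independent aT uT t
Independent-patch {aT = aT} {uT = uT} {s} {t} xs aT-sym I t≡s uS⊆uT outer-edges inner-within inner-edges =
  record { within = within′ ; no-edge = no-edge′ }
  where
    within′ : ∀ i → t i ≡ true → uT i ≡ true
    within′ i tᵢ with DecMembership._∈?_ _≟_ i xs
    ... | yes i∈xs = inner-within i i∈xs tᵢ
    ... | no  i∉xs = uS⊆uT i i∉xs (I .within i (trans (sym (t≡s i i∉xs)) tᵢ))
    no-edge′ : ∀ i j → aT i j ≡ true → t i ∧ t j ≡ false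
    no-edge′ i j aᵢⱼ with DecMembership._∈?_ _≟_ i xs | DecMembership._∈?_ _≟_ j xs
    ... | yes i∈xs | _        = inner-edges i j i∈xs aᵢⱼ
    ... | no  _    | yes j∈xs = trans (∧-comm (t i) (t j)) (inner-edges j i j∈xs (trans (aT-sym j i) aᵢⱼ))
    ... | no  i∉xs | no  j∉xs rewrite t≡s i i∉xs | t≡s j j∉xs = I .no-edge i j (outer-edges i j i∉xs j∉xs aᵢⱼ)

-- Deleting vertices, adding an edge, vertices of degree two

∈-two : ∀ {A : Set} {xs : List A} {x y z} → length xs ≡ 2 →
        x ∈ xs → y ∈ xs → z ∈ xs → x ≢ y → z ≡ x ⊎ z ≡ y
∈-two {xs = _ ∷ _ ∷ []} refl (here refl)         (here refl)         _                   x≢y = contradiction refl x≢y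
∈-two {xs = _ ∷ _ ∷ []} refl (there (here refl)) (there (here refl)) _                   x≢y = contradiction refl x≢y
∈-two {xs = _ ∷ _ ∷ []} refl (here refl)         (there (here refl)) (here refl)         _   = inj₁ refl
∈-two {xs = _ ∷ _ ∷ []} refl (here refl)         (there (here refl)) (there (here refl)) _   = inj₂ refl
∈-two {xs = _ ∷ _ ∷ []} refl (there (here refl)) (here refl)         (here refl)         _   = inj₂ refl
∈-two {xs = _ ∷ _ ∷ []} refl (there (here refl)) (here refl)         (there (here refl)) _   = inj₁ refl

degree-two-neighbours : ∀ {n} (a : Fin n → Fin n → Bool) {v x y} → degree a v ≡ 2 →
                        a v x ≡ true → a v y ≡ true → x ≢ y →
                        ∀ z → a v z ≡ true → z ≡ x ⊎ z ≡ y
degree-two-neighbours {n} a {v} deg aᵥₓ aᵥᵧ x≢y z aᵥ₂ =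
  ∈-two deg (neighbour aᵥₓ) (neighbour aᵥᵧ) (neighbour aᵥ₂) x≢y
  where
    neighbour : ∀ {j} → a v j ≡ true → j ∈ filter (λ u → a v u Bool.≟ true) (allFin n)
    neighbour {j} aᵥⱼ = ∈-filter⁺ (λ u → a v u Bool.≟ true) (∈-allFin j) aᵥⱼ

lookup-fullSet : ∀ {n} (i : Fin n) → lookup (fullSet {n}) i ≡ true
lookup-fullSet Fin.zero    = refl
lookup-fullSet (Fin.suc i) = lookup-fullSet i

∖ˡ-keeps-false : ∀ {n} (U : Subset n) xs {i} → lookup U i ≡ false → lookup (U ∖ˡ xs) i ≡ false
∖ˡ-keeps-false U []       Uᵢ = Uᵢ
∖ˡ-keeps-false U (x ∷ xs) {i} Uᵢ with i ≟ x
... | yes refl = ∖ˡ-keeps-false _ xs (lookup∘updateAt i U)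
... | no i≢x   = ∖ˡ-keeps-false _ xs (trans (lookup∘updateAt′ i x i≢x U) Uᵢ)

lookup-∖ˡ-∈ : ∀ {n} (U : Subset n) {xs i} → i ∈ xs → lookup (U ∖ˡ xs) i ≡ false
lookup-∖ˡ-∈ U {x ∷ xs} (here refl)  = ∖ˡ-keeps-false _ xs (lookup∘updateAt x U)
lookup-∖ˡ-∈ U {x ∷ xs} (there i∈xs) = lookup-∖ˡ-∈ _ i∈xs

lookup-∖ˡ-∉ : ∀ {n} (U : Subset n) {xs i} → i ∉ xs → lookup (U ∖ˡ xs) i ≡ lookup U i
lookup-∖ˡ-∉ U {[]}     _    = refl
lookup-∖ˡ-∉ U {x ∷ xs} {i} i∉ =
  trans (lookup-∖ˡ-∉ _ (λ i∈xs → i∉ (there i∈xs))) (lookup∘updateAt′ i x (λ i≡x → i∉ (here i≡x)) U)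

lookup-fullSet∖ˡ : ∀ {n} {xs} {i : Fin n} → i ∉ xs → lookup (fullSet ∖ˡ xs) i ≡ true
lookup-fullSet∖ˡ {i = i} i∉xs = trans (lookup-∖ˡ-∉ fullSet i∉xs) (lookup-fullSet i)

addEdge-⊇ : ∀ {n} (a : Fin n → Fin n → Bool) x y {i j} → a i j ≡ true → addEdge a x y i j ≡ true
addEdge-⊇ a x y aᵢⱼ rewrite aᵢⱼ = refl

addEdge-new : ∀ {n} (a : Fin n → Fin n → Bool) x y → addEdge a x y x y ≡ true
addEdge-new a x y rewrite ==-refl x | ==-refl y = ∨-zeroʳ (a x y)

addEdge-true⁻ : ∀ {n} (a : Fin n → Fin n → Bool) x y {i j} → addEdge a x y i j ≡ true →
                a i j ≡ true ⊎ (i ≡ x × j ≡ y) ⊎ (i ≡ y × j ≡ x)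
addEdge-true⁻ a x y {i} {j} e with a i j | i == x in i==x | j == y in j==y | i == y in i==y | j == x in j==x
... | true  | _     | _     | _     | _     = inj₁ refl
... | false | true  | true  | _     | _     = inj₂ (inj₁ (==⇒≡ i==x , ==⇒≡ j==y))
... | false | _     | _     | true  | true  = inj₂ (inj₂ (==⇒≡ i==y , ==⇒≡ j==x))
... | false | false | _     | false | _     with () ← e
... | false | false | _     | true  | false with () ← e
... | false | true  | false | false | _     with () ← e
... | false | true  | false | true  | false with () ← e

addEdge-sym : ∀ {n} (a : Fin n → Fin n → Bool) → (∀ i j → a i j ≡ a j i) →
              ∀ x y i j → addEdge a x y i j ≡ addEdge a x y j i
addEdge-sym a a-sym x y i j =
  cong₂ _∨_ (a-sym i j) (trans (∨-comm (i == x ∧ j == y) _) (cong₂ _∨_ (∧-comm (i == y) _) (∧-comm (i == x) _)))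

-- Best choices on a path with two inner vertices

Prefers : Bool → ℚ → ℚ → Set
Prefers true  x y = y ≤ x
Prefers false x y = x ≤ y

prefers? : ∀ x y → Σ Bool λ d → Prefers d x y
prefers? x y with ≤-total y x
... | inj₁ y≤x = true  , y≤x
... | inj₂ x≤y = false , x≤y

-- Whether to take x, resp. y, on a path p – x – y – q given whether its ends are taken;
-- d records which of x and y is heavier.
pickFirst pickSecond : Bool → Bool → Bool → Bool
pickFirst  d p q = not p ∧ (d ∨ q)
pickSecond d p q = not q ∧ (not d ∨ p)

PathIndependent : Bool → Bool → Bool → Bool → Set
PathIndependent p x y q = p ∧ x ≡ false × x ∧ y ≡ false × y ∧ q ≡ false

PathIndependent-reverse : ∀ {p x y q} → PathIndependent p x y q → PathIndependent q y x p
PathIndependent-reverse {p} {x} {y} {q} (px , xy , yq) =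
  trans (∧-comm q y) yq , trans (∧-comm y x) xy , trans (∧-comm x p) px

PathIndependent-subst : ∀ {p x y q p′ x′ y′ q′} → p ≡ p′ → x ≡ x′ → y ≡ y′ → q ≡ q′ →
                        PathIndependent p x y q → PathIndependent p′ x′ y′ q′
PathIndependent-subst refl refl refl refl path = path

picks-independent : ∀ d p q → PathIndependent p (pickFirst d p q) (pickSecond d p q) q
picks-independent true  true  true  = refl , refl , refl
picks-independent true  true  false = refl , refl , refl
picks-independent true  false true  = refl , refl , refl
picks-independent true  false false = refl , refl , refl
picks-independent false true  true  = refl , refl , refl
picks-independent false true  false = refl , refl , refl
picks-independent false false true  = refl , refl , refl
picks-independent false false false = refl , refl , refl

path-bound-first : ∀ p q x y {wx wy} → 0ℚ ≤ wx → 0ℚ ≤ wy → wy ≤ wx → PathIndependent p x y q →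
                   ite x wx + ite y wy ≤ ite (pickFirst true p q) wx + ite (pickSecond true p q) wy
path-bound-first p     q     false false 0≤wx 0≤wy _ _ =
  +-mono-≤ (ite-nonneg (pickFirst true p q) 0≤wx) (ite-nonneg (pickSecond true p q) 0≤wy)
path-bound-first false q     true  false {wx} 0≤wx 0≤wy _ _ = +-monoʳ-≤ wx (ite-nonneg (pickSecond true false q) 0≤wy)
path-bound-first true  false false true  0≤wx 0≤wy _ _ = ≤-refl
path-bound-first false false false true  {wx} {wy} 0≤wx 0≤wy wy≤wx _ = begin
  0ℚ + wy   ≡⟨ +-identityˡ wy ⟩
  wy        ≤⟨ wy≤wx ⟩
  wx        ≡⟨ +-identityʳ wx ⟨
  wx + 0ℚ   ∎
  where open Data.Rational.Properties.≤-Reasoning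

path-bound : ∀ d p q x y {wx wy} → 0ℚ ≤ wx → 0ℚ ≤ wy → Prefers d wx wy → PathIndependent p x y q →
             ite x wx + ite y wy ≤ ite (pickFirst d p q) wx + ite (pickSecond d p q) wy
path-bound true  p q x y 0≤wx 0≤wy wy≤wx path = path-bound-first p q x y 0≤wx 0≤wy wy≤wx path
path-bound false p q x y {wx} {wy} 0≤wx 0≤wy wx≤wy path = begin
  ite x wx + ite y wy                                          ≡⟨ +-comm (ite x wx) _ ⟩
  ite y wy + ite x wx                                          ≤⟨ path-bound-first q p y x 0≤wy 0≤wx wx≤wy reversed ⟩
  ite (pickFirst true q p) wy + ite (pickSecond true q p) wx    ≡⟨ +-comm (ite (pickFirst true q p) wy) _ ⟩
  ite (pickFirst false p q) wx + ite (pickSecond false p q) wy  ∎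
  where
    open Data.Rational.Properties.≤-Reasoning
    reversed : PathIndependent q y x p
    reversed = PathIndependent-reverse {p} {x} {y} {q} path

lone-bound : ∀ p q x {wx} → 0ℚ ≤ wx → p ∧ x ≡ false → x ∧ q ≡ false → ite x wx ≤ ite (not p ∧ not q) wx
lone-bound p     q     false 0≤wx _ _ = ite-nonneg (not p ∧ not q) 0≤wx
lone-bound false false true  _    _ _ = ≤-refl

neither-∧ˡ : ∀ p q → (not p ∧ not q) ∧ p ≡ false
neither-∧ˡ false q = ∧-zeroʳ (not q)
neither-∧ˡ true  q = refl

neither-∧ʳ : ∀ p q → (not p ∧ not q) ∧ q ≡ false
neither-∧ʳ false false = refl
neither-∧ʳ false true  = refl
neither-∧ʳ true  q     = refl

-- Opaque, so that unification can read the four summands off a  quad  expression.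
opaque
  quad : ℚ → ℚ → ℚ → ℚ → ℚ
  quad a b c d = a + (b + (c + (d + 0ℚ)))

  two-paths-≤ : ∀ {a b c d a′ b′ c′ d′} → a + b ≤ a′ + b′ → d + c ≤ d′ + c′ → quad a b c d ≤ quad a′ b′ c′ d′
  two-paths-≤ {a} {b} {c} {d} {a′} {b′} {c′} {d′} ab≤ dc≤ = begin
    quad a b c d            ≡⟨ regroup a b c d ⟩
    (a + b) + (d + c)       ≤⟨ +-mono-≤ ab≤ dc≤ ⟩
    (a′ + b′) + (d′ + c′)   ≡⟨ regroup a′ b′ c′ d′ ⟨
    quad a′ b′ c′ d′        ∎
    where
      open Data.Rational.Properties.≤-Reasoning
      regroup : ∀ a b c d → quad a b c d ≡ (a + b) + (d + c)
      regroup = solve 4 (λ a b c d → a :+ (b :+ (c :+ (d :+ con 0ℚ))) := (a :+ b) :+ (d :+ c)) refl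

  merge-paths : ∀ b c x₂ x₃ x₅ x₆ →
                quad (ite b x₂) (ite c x₃) (ite c x₅) (ite b x₆) ≡ quad (ite b (x₂ + x₆)) (ite c (x₃ + x₅)) 0ℚ 0ℚ
  merge-paths b c x₂ x₃ x₅ x₆ rewrite ite-+ b x₂ x₆ | ite-+ c x₃ x₅ =
    solve 4 (λ a b c d → a :+ (b :+ (c :+ (d :+ con 0ℚ))) := (a :+ d) :+ ((b :+ c) :+ (con 0ℚ :+ (con 0ℚ :+ con 0ℚ))))
      refl (ite b x₂) (ite c x₃) (ite c x₅) (ite b x₆)

  merge-v₃v₅ : ∀ x₃ x₅ → 0ℚ + (x₃ + (x₅ + (0ℚ + 0ℚ))) ≡ 0ℚ + ((x₃ + x₅) + (0ℚ + (0ℚ + 0ℚ)))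
  merge-v₃v₅ = solve 2 (λ x₃ x₅ → con 0ℚ :+ (x₃ :+ (x₅ :+ (con 0ℚ :+ con 0ℚ)))
                               := con 0ℚ :+ ((x₃ :+ x₅) :+ (con 0ℚ :+ (con 0ℚ :+ con 0ℚ)))) refl

  merge-v₂v₆ : ∀ x₂ x₆ → x₂ + (0ℚ + (0ℚ + (x₆ + 0ℚ))) ≡ (x₂ + x₆) + (0ℚ + (0ℚ + (0ℚ + 0ℚ)))
  merge-v₂v₆ = solve 2 (λ x₂ x₆ → x₂ :+ (con 0ℚ :+ (con 0ℚ :+ (x₆ :+ con 0ℚ)))
                               := (x₂ :+ x₆) :+ (con 0ℚ :+ (con 0ℚ :+ (con 0ℚ :+ con 0ℚ)))) refl

  -- The origin of the new weight of v₅: when neither end is taken, the best value x₆ + x₃ of G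
  -- is split into the heavier of the two merged vertices and the new weight of v₅.
  merge-paths-with-slack : ∀ d p q {x₂ x₃ x₅ x₆} → Prefers d (x₂ + x₆) (x₃ + x₅) →
    quad (ite (pickFirst false p q) x₂) (ite (pickSecond false p q) x₃)
         (ite (pickSecond true p q) x₅) (ite (pickFirst true p q) x₆)
    ≡ quad (ite (pickFirst d p q) (x₂ + x₆)) (ite (pickSecond d p q) (x₃ + x₅))
           (ite (not p ∧ not q) (x₆ + x₃ - ((x₂ + x₆) ⊔ (x₃ + x₅)))) 0ℚ
  merge-paths-with-slack true false false {x₂} {x₃} {x₅} {x₆} x₃₅≤x₂₆ rewrite p≥q⇒p⊔q≡p x₃₅≤x₂₆ =
    solve 4 (λ x₂ x₃ x₅ x₆ → con 0ℚ :+ (x₃ :+ (con 0ℚ :+ (x₆ :+ con 0ℚ)))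
                            := (x₂ :+ x₆) :+ (con 0ℚ :+ ((x₆ :+ x₃ :- (x₂ :+ x₆)) :+ (con 0ℚ :+ con 0ℚ)))) refl x₂ x₃ x₅ x₆
  merge-paths-with-slack false false false {x₂} {x₃} {x₅} {x₆} x₂₆≤x₃₅ rewrite p≤q⇒p⊔q≡q x₂₆≤x₃₅ =
    solve 4 (λ x₂ x₃ x₅ x₆ → con 0ℚ :+ (x₃ :+ (con 0ℚ :+ (x₆ :+ con 0ℚ)))
                            := con 0ℚ :+ ((x₃ :+ x₅) :+ ((x₆ :+ x₃ :- (x₃ :+ x₅)) :+ (con 0ℚ :+ con 0ℚ)))) refl x₂ x₃ x₅ x₆
  merge-paths-with-slack true  true  false {x₃ = x₃} {x₅} _ = merge-v₃v₅ x₃ x₅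
  merge-paths-with-slack false true  false {x₃ = x₃} {x₅} _ = merge-v₃v₅ x₃ x₅
  merge-paths-with-slack true  false true  {x₂} {x₆ = x₆} _ = merge-v₂v₆ x₂ x₆
  merge-paths-with-slack false false true  {x₂} {x₆ = x₆} _ = merge-v₂v₆ x₂ x₆
  merge-paths-with-slack true  true  true  _ = refl
  merge-paths-with-slack false true  true  _ = refl

quad-ite-cong : ∀ {b₂ b₃ b₅ b₆ c₂ c₃ c₅ c₆ x₂ x₃ x₅ x₆} → b₂ ≡ c₂ → b₃ ≡ c₃ → b₅ ≡ c₅ → b₆ ≡ c₆ →
                quad (ite b₂ x₂) (ite b₃ x₃) (ite b₅ x₅) (ite b₆ x₆) ≡
                quad (ite c₂ x₂) (ite c₃ x₃) (ite c₅ x₅) (ite c₆ x₆)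
quad-ite-cong refl refl refl refl = refl

slack-nonneg : ∀ {x₂ x₃ x₅ x₆} → x₂ ≤ x₃ → x₅ ≤ x₆ → 0ℚ ≤ x₆ + x₃ - ((x₂ + x₆) ⊔ (x₃ + x₅))
slack-nonneg {x₂} {x₃} {x₅} {x₆} x₂≤x₃ x₅≤x₆ = begin
  0ℚ                ≡⟨ +-inverseʳ M ⟨
  M - M             ≤⟨ +-monoˡ-≤ (- M) (⊔-lub x₂₆≤ x₃₅≤) ⟩
  x₆ + x₃ - M       ∎
  where
    open Data.Rational.Properties.≤-Reasoning
    M : ℚ
    M = (x₂ + x₆) ⊔ (x₃ + x₅)
    x₂₆≤ : x₂ + x₆ ≤ x₆ + x₃
    x₂₆≤ = ≤-trans (+-monoˡ-≤ x₆ x₂≤x₃) (≤-reflexive (+-comm x₃ x₆))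
    x₃₅≤ : x₃ + x₅ ≤ x₆ + x₃
    x₃₅≤ = ≤-trans (+-monoʳ-≤ x₃ x₅≤x₆) (≤-reflexive (+-comm x₃ x₆))

-- The two reductions of the six-cycle

module SixCycle {n} (a : Fin n → Fin n → Bool) (a-sym : ∀ i j → a i j ≡ a j i)
  (v₁ v₂ v₃ v₄ v₅ v₆ : Fin n)
  (v₁≢v₂ : v₁ ≢ v₂) (v₁≢v₃ : v₁ ≢ v₃) (v₁≢v₅ : v₁ ≢ v₅) (v₁≢v₆ : v₁ ≢ v₆)
  (v₂≢v₃ : v₂ ≢ v₃) (v₂≢v₄ : v₂ ≢ v₄) (v₂≢v₅ : v₂ ≢ v₅) (v₂≢v₆ : v₂ ≢ v₆)
  (v₃≢v₄ : v₃ ≢ v₄) (v₃≢v₅ : v₃ ≢ v₅) (v₃≢v₆ : v₃ ≢ v₆)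
  (v₄≢v₅ : v₄ ≢ v₅) (v₄≢v₆ : v₄ ≢ v₆) (v₅≢v₆ : v₅ ≢ v₆)
  (e₁₂ : a v₁ v₂ ≡ true) (e₂₃ : a v₂ v₃ ≡ true) (e₃₄ : a v₃ v₄ ≡ true)
  (e₄₅ : a v₄ v₅ ≡ true) (e₅₆ : a v₅ v₆ ≡ true) (e₆₁ : a v₆ v₁ ≡ true)
  (deg₂ : degree a v₂ ≡ 2) (deg₃ : degree a v₃ ≡ 2) (deg₅ : degree a v₅ ≡ 2) (deg₆ : degree a v₆ ≡ 2)
  (w : Fin n → ℚ) (w-nonneg : ∀ i → 0ℚ ≤ w i) (w₅≤w₆ : w v₅ ≤ w v₆)
  where

  inner : List (Fin n)
  inner = v₂ ∷ v₃ ∷ v₅ ∷ v₆ ∷ []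

  inner-unique : Unique inner
  inner-unique = (v₂≢v₃ ∷ v₂≢v₅ ∷ v₂≢v₆ ∷ []) ∷ (v₃≢v₅ ∷ v₃≢v₆ ∷ []) ∷ (v₅≢v₆ ∷ []) ∷ [] ∷ []

  v₁∉inner : v₁ ∉ inner
  v₁∉inner = All¬⇒¬Any (v₁≢v₂ ∷ v₁≢v₃ ∷ v₁≢v₅ ∷ v₁≢v₆ ∷ [])

  v₄∉inner : v₄ ∉ inner
  v₄∉inner = All¬⇒¬Any (≢-sym v₂≢v₄ ∷ ≢-sym v₃≢v₄ ∷ v₄≢v₅ ∷ v₄≢v₆ ∷ [])

  N₂ : ∀ j → a v₂ j ≡ true → j ≡ v₁ ⊎ j ≡ v₃
  N₂ = degree-two-neighbours a deg₂ (trans (a-sym v₂ v₁) e₁₂) e₂₃ v₁≢v₃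

  N₃ : ∀ j → a v₃ j ≡ true → j ≡ v₂ ⊎ j ≡ v₄
  N₃ = degree-two-neighbours a deg₃ (trans (a-sym v₃ v₂) e₂₃) e₃₄ v₂≢v₄

  N₅ : ∀ j → a v₅ j ≡ true → j ≡ v₄ ⊎ j ≡ v₆
  N₅ = degree-two-neighbours a deg₅ (trans (a-sym v₅ v₄) e₄₅) e₅₆ v₄≢v₆

  N₆ : ∀ j → a v₆ j ≡ true → j ≡ v₅ ⊎ j ≡ v₁
  N₆ = degree-two-neighbours a deg₆ (trans (a-sym v₆ v₅) e₅₆) e₆₁ (≢-sym v₁≢v₅)

  cycle-paths : ∀ {aS : Fin n → Fin n → Bool} {uS s : Fin n → Bool} →
                (∀ {i j} → a i j ≡ true → aS i j ≡ true) → Independent aS uS s →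
                PathIndependent (s v₁) (s v₂) (s v₃) (s v₄) × PathIndependent (s v₁) (s v₆) (s v₅) (s v₄)
  cycle-paths {s = s} a⊆aS I =
    (edge e₁₂ , edge e₂₃ , edge e₃₄) , (reversed e₆₁ , reversed e₅₆ , reversed e₄₅)
    where
      edge : ∀ {i j} → a i j ≡ true → s i ∧ s j ≡ false
      edge {i} {j} aᵢⱼ = I .no-edge i j (a⊆aS aᵢⱼ)
      reversed : ∀ {i j} → a i j ≡ true → s j ∧ s i ≡ false
      reversed {i} {j} aᵢⱼ = trans (∧-comm (s j) (s i)) (edge aᵢⱼ)

  cycle-edges : ∀ {t : Fin n → Bool} →
                PathIndependent (t v₁) (t v₂) (t v₃) (t v₄) → PathIndependent (t v₁) (t v₆) (t v₅) (t v₄) →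
                ∀ x j → x ∈ inner → a x j ≡ true → t x ∧ t j ≡ false
  cycle-edges {t} (t₁₂ , t₂₃ , t₃₄) (t₁₆ , t₆₅ , t₅₄) x j x∈inner aₓⱼ with x∈inner
  ... | here refl with N₂ j aₓⱼ
  ...   | inj₁ refl = trans (∧-comm (t v₂) (t v₁)) t₁₂
  ...   | inj₂ refl = t₂₃
  cycle-edges {t} (t₁₂ , t₂₃ , t₃₄) (t₁₆ , t₆₅ , t₅₄) x j x∈inner aₓⱼ | there (here refl) with N₃ j aₓⱼ
  ...   | inj₁ refl = trans (∧-comm (t v₃) (t v₂)) t₂₃
  ...   | inj₂ refl = t₃₄
  cycle-edges {t} (t₁₂ , t₂₃ , t₃₄) (t₁₆ , t₆₅ , t₅₄) x j x∈inner aₓⱼ | there (there (here refl)) with N₅ j aₓⱼ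
  ...   | inj₁ refl = t₅₄
  ...   | inj₂ refl = trans (∧-comm (t v₅) (t v₆)) t₆₅
  cycle-edges {t} (t₁₂ , t₂₃ , t₃₄) (t₁₆ , t₆₅ , t₅₄) x j x∈inner aₓⱼ | there (there (there (here refl))) with N₆ j aₓⱼ
  ...   | inj₁ refl = t₆₅
  ...   | inj₂ refl = trans (∧-comm (t v₆) (t v₁)) t₁₆

  opaque
    unfolding quad
    weightOn-inner : ∀ ω s → weightOn ω s inner ≡
                             quad (ite (s v₂) (ω v₂)) (ite (s v₃) (ω v₃)) (ite (s v₅) (ω v₅)) (ite (s v₆) (ω v₆))
    weightOn-inner ω s = refl

  setInner : (Fin n → Bool) → Bool → Bool → Bool → Bool → Fin n → Bool
  setInner s b₂ b₃ b₅ b₆ = update (update (update (update s v₆ b₆) v₅ b₅) v₃ b₃) v₂ b₂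

  module _ (s : Fin n → Bool) (b₂ b₃ b₅ b₆ : Bool) where

    private
      s₆ s₅ s₃ t : Fin n → Bool
      s₆ = update s v₆ b₆
      s₅ = update s₆ v₅ b₅
      s₃ = update s₅ v₃ b₃
      t  = update s₃ v₂ b₂

    setInner-v₂ : t v₂ ≡ b₂
    setInner-v₂ = update-same s₃ v₂ b₂

    setInner-v₃ : t v₃ ≡ b₃
    setInner-v₃ = trans (update-other s₃ b₂ (≢-sym v₂≢v₃)) (update-same s₅ v₃ b₃)

    setInner-v₅ : t v₅ ≡ b₅
    setInner-v₅ = trans (update-other s₃ b₂ (≢-sym v₂≢v₅))
                   (trans (update-other s₅ b₃ (≢-sym v₃≢v₅)) (update-same s₆ v₅ b₅))

    setInner-v₆ : t v₆ ≡ b₆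
    setInner-v₆ = trans (update-other s₃ b₂ (≢-sym v₂≢v₆)) (trans (update-other s₅ b₃ (≢-sym v₃≢v₆))
                  (trans (update-other s₆ b₅ (≢-sym v₅≢v₆)) (update-same s v₆ b₆)))

    setInner-outer : ∀ i → i ∉ inner → t i ≡ s i
    setInner-outer i i∉inner =
      trans (update-other s₃ b₂ (λ i≡v₂ → i∉inner (here i≡v₂)))
      (trans (update-other s₅ b₃ (λ i≡v₃ → i∉inner (there (here i≡v₃))))
      (trans (update-other s₆ b₅ (λ i≡v₅ → i∉inner (there (there (here i≡v₅)))))
             (update-other s b₆ (λ i≡v₆ → i∉inner (there (there (there (here i≡v₆))))))))

    weightOn-setInner : ∀ ω → weightOn ω t inner ≡ quad (ite b₂ (ω v₂)) (ite b₃ (ω v₃)) (ite b₅ (ω v₅)) (ite b₆ (ω v₆))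
    weightOn-setInner ω = trans (weightOn-inner ω t) (quad-ite-cong setInner-v₂ setInner-v₃ setInner-v₅ setInner-v₆)

    setInner-edges : PathIndependent (s v₁) b₂ b₃ (s v₄) → PathIndependent (s v₁) b₆ b₅ (s v₄) →
                   ∀ x j → x ∈ inner → a x j ≡ true → t x ∧ t j ≡ false
    setInner-edges path₁ path₂ = cycle-edges {t}
      (PathIndependent-subst (sym t₁) (sym setInner-v₂) (sym setInner-v₃) (sym t₄) path₁)
      (PathIndependent-subst (sym t₁) (sym setInner-v₆) (sym setInner-v₅) (sym t₄) path₂)
      where
        t₁ : t v₁ ≡ s v₁
        t₁ = setInner-outer v₁ v₁∉inner
        t₄ : t v₄ ≡ s v₄
        t₄ = setInner-outer v₄ v₄∉inner

  -- G′ and G″ are the reduced graphs of cases (1) and (2).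
  U′ U″ : Subset n
  U′ = fullSet ∖ˡ (v₅ ∷ v₆ ∷ [])
  U″ = fullSet ∖ˡ (v₆ ∷ [])

  a″ : Fin n → Fin n → Bool
  a″ = addEdge a v₁ v₅

  slack : ℚ
  slack = w v₆ + w v₃ - ((w v₂ + w v₆) ⊔ (w v₃ + w v₅))

  w′ w″ : Fin n → ℚ
  w′ = setW (setW w v₂ (w v₂ + w v₆)) v₃ (w v₃ + w v₅)
  w″ = setW w′ v₅ slack

  toG : Bool → (Fin n → Bool) → Fin n → Bool
  toG d s = setInner s (pickFirst d (s v₁) (s v₄)) (pickSecond d (s v₁) (s v₄))
                     (pickSecond true (s v₁) (s v₄)) (pickFirst true (s v₁) (s v₄))

  toG′ : (Fin n → Bool) → Fin n → Bool
  toG′ s = setInner s (pickFirst true (s v₁) (s v₄)) (pickSecond true (s v₁) (s v₄)) false false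

  toG″ : Bool → (Fin n → Bool) → Fin n → Bool
  toG″ d s = setInner s (pickFirst d (s v₁) (s v₄)) (pickSecond d (s v₁) (s v₄))
                        (not (s v₁) ∧ not (s v₄)) false

  toG-independent : ∀ d {aS : Fin n → Fin n → Bool} {uS s : Fin n → Bool} →
                    (∀ {i j} → a i j ≡ true → aS i j ≡ true) → Independent aS uS s →
                    Independent a (lookup fullSet) (toG d s)
  toG-independent d {s = s} a⊆aS I =
    Independent-patch inner a-sym I (setInner-outer s _ _ _ _) (λ i _ _ → lookup-fullSet i)
      (λ _ _ _ _ → a⊆aS) (λ x _ _ → lookup-fullSet x)
      (setInner-edges s _ _ _ _ (picks-independent d (s v₁) (s v₄)) (picks-independent true (s v₁) (s v₄)))

  toG′-independent : ∀ {s} → Independent a (lookup fullSet) s → Independent a (lookup U′) (toG′ s)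
  toG′-independent {s} I =
    Independent-patch inner a-sym I (setInner-outer s _ _ _ _) outer-within (λ _ _ _ _ aᵢⱼ → aᵢⱼ) inner-within
      (setInner-edges s _ _ _ _ (picks-independent true p q) (∧-zeroʳ p , refl , refl))
    where
      p q : Bool
      p = s v₁
      q = s v₄
      outer-within : ∀ i → i ∉ inner → lookup fullSet i ≡ true → lookup U′ i ≡ true
      outer-within i i∉inner _ = lookup-fullSet∖ˡ {xs = v₅ ∷ v₆ ∷ []} λ
        { (here i≡v₅)         → i∉inner (there (there (here i≡v₅)))
        ; (there (here i≡v₆)) → i∉inner (there (there (there (here i≡v₆)))) }
      inner-within : ∀ x → x ∈ inner → toG′ s x ≡ true → lookup U′ x ≡ true
      inner-within _ (here refl)                        _  = lookup-fullSet∖ˡ (All¬⇒¬Any (v₂≢v₅ ∷ v₂≢v₆ ∷ []))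
      inner-within _ (there (here refl))                _  = lookup-fullSet∖ˡ (All¬⇒¬Any (v₃≢v₅ ∷ v₃≢v₆ ∷ []))
      inner-within _ (there (there (here refl)))        t₅ with () ← trans (sym t₅) (setInner-v₅ s _ _ _ _)
      inner-within _ (there (there (there (here refl)))) t₆ with () ← trans (sym t₆) (setInner-v₆ s _ _ _ _)

  toG″-independent : ∀ d {s} → Independent a (lookup fullSet) s → Independent a″ (lookup U″) (toG″ d s)
  toG″-independent d {s} I =
    Independent-patch inner (addEdge-sym a a-sym v₁ v₅) I (setInner-outer s _ _ _ _)
      outer-within outer-edges inner-within inner-edges
    where
      p q : Bool
      p = s v₁
      q = s v₄
      t : Fin n → Bool
      t = toG″ d s
      v₅∈inner : v₅ ∈ inner
      v₅∈inner = there (there (here refl))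
      outer-within : ∀ i → i ∉ inner → lookup fullSet i ≡ true → lookup U″ i ≡ true
      outer-within i i∉inner _ = lookup-fullSet∖ˡ {xs = v₆ ∷ []} λ { (here i≡v₆) → i∉inner (there (there (there (here i≡v₆)))) }
      outer-edges : ∀ i j → i ∉ inner → j ∉ inner → a″ i j ≡ true → a i j ≡ true
      outer-edges i j i∉inner j∉inner a″ᵢⱼ with addEdge-true⁻ a v₁ v₅ a″ᵢⱼ
      ... | inj₁ aᵢⱼ             = aᵢⱼ
      ... | inj₂ (inj₁ (_ , refl)) = contradiction v₅∈inner j∉inner
      ... | inj₂ (inj₂ (refl , _)) = contradiction v₅∈inner i∉inner
      inner-within : ∀ x → x ∈ inner → t x ≡ true → lookup U″ x ≡ true
      inner-within _ (here refl)                        _  = lookup-fullSet∖ˡ (All¬⇒¬Any (v₂≢v₆ ∷ []))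
      inner-within _ (there (here refl))                _  = lookup-fullSet∖ˡ (All¬⇒¬Any (v₃≢v₆ ∷ []))
      inner-within _ (there (there (here refl)))        _  = lookup-fullSet∖ˡ (All¬⇒¬Any (v₅≢v₆ ∷ []))
      inner-within _ (there (there (there (here refl)))) t₆ with () ← trans (sym t₆) (setInner-v₆ s _ _ _ _)
      inner-edges : ∀ x j → x ∈ inner → a″ x j ≡ true → t x ∧ t j ≡ false
      inner-edges x j x∈inner a″ₓⱼ with addEdge-true⁻ a v₁ v₅ a″ₓⱼ
      ... | inj₁ aₓⱼ =
        setInner-edges s _ _ _ _ (picks-independent d p q) (∧-zeroʳ p , refl , neither-∧ʳ p q) x j x∈inner aₓⱼ
      ... | inj₂ (inj₁ (refl , _))   = contradiction x∈inner v₁∉inner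
      ... | inj₂ (inj₂ (refl , refl)) =
        subst₂ (λ b c → b ∧ c ≡ false) (sym (setInner-v₅ s _ _ _ _)) (sym (setInner-outer s _ _ _ _ v₁ v₁∉inner))
               (neither-∧ˡ p q)

  w′-v₂ : w′ v₂ ≡ w v₂ + w v₆
  w′-v₂ = trans (update-other (setW w v₂ (w v₂ + w v₆)) (w v₃ + w v₅) v₂≢v₃) (update-same w v₂ (w v₂ + w v₆))

  w′-v₃ : w′ v₃ ≡ w v₃ + w v₅
  w′-v₃ = update-same (setW w v₂ (w v₂ + w v₆)) v₃ (w v₃ + w v₅)

  w′-outer : ∀ i → i ∉ inner → w′ i ≡ w i
  w′-outer i i∉inner =
    trans (update-other (setW w v₂ (w v₂ + w v₆)) (w v₃ + w v₅) (λ i≡v₃ → i∉inner (there (here i≡v₃))))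
          (update-other w (w v₂ + w v₆) (λ i≡v₂ → i∉inner (here i≡v₂)))

  w″-v₅ : w″ v₅ ≡ slack
  w″-v₅ = update-same w′ v₅ slack

  w″-unchanged : ∀ {i} → i ≢ v₅ → w″ i ≡ w′ i
  w″-unchanged i≢v₅ = update-other w′ slack i≢v₅

  w″-v₂ : w″ v₂ ≡ w v₂ + w v₆
  w″-v₂ = trans (w″-unchanged v₂≢v₅) w′-v₂

  w″-v₃ : w″ v₃ ≡ w v₃ + w v₅
  w″-v₃ = trans (w″-unchanged v₃≢v₅) w′-v₃

  w″-outer : ∀ i → i ∉ inner → w″ i ≡ w i
  w″-outer i i∉inner = trans (w″-unchanged (λ i≡v₅ → i∉inner (there (there (here i≡v₅))))) (w′-outer i i∉inner)

  nonneg-+ : ∀ i j → 0ℚ ≤ w i + w j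
  nonneg-+ i j = +-mono-≤ (w-nonneg i) (w-nonneg j)

  G≼G′ : w v₃ ≤ w v₂ → ∀ s → Independent a (lookup fullSet) s →
         Σ (Fin n → Bool) λ t → Independent a (lookup U′) t × weight w s ≤ weight w′ t
  G≼G′ w₃≤w₂ s I =
    toG′ s , toG′-independent I , weight-≤-of-local inner-unique (setInner-outer s _ _ _ _) w′-outer local
    where
      open Data.Rational.Properties.≤-Reasoning
      p q : Bool
      p = s v₁
      q = s v₄
      c₂ c₃ : Bool
      c₂ = pickFirst true p q
      c₃ = pickSecond true p q
      local : weightOn w s inner ≤ weightOn w′ (toG′ s) inner
      local = begin
        weightOn w s inner
          ≡⟨ weightOn-inner w s ⟩
        quad (ite (s v₂) (w v₂)) (ite (s v₃) (w v₃)) (ite (s v₅) (w v₅)) (ite (s v₆) (w v₆))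
          ≤⟨ two-paths-≤ (path-bound true p q _ _ (w-nonneg v₂) (w-nonneg v₃) w₃≤w₂ (proj₁ (cycle-paths id I)))
                         (path-bound true p q _ _ (w-nonneg v₆) (w-nonneg v₅) w₅≤w₆ (proj₂ (cycle-paths id I))) ⟩
        quad (ite c₂ (w v₂)) (ite c₃ (w v₃)) (ite c₃ (w v₅)) (ite c₂ (w v₆))
          ≡⟨ merge-paths c₂ c₃ (w v₂) (w v₃) (w v₅) (w v₆) ⟩
        quad (ite c₂ (w v₂ + w v₆)) (ite c₃ (w v₃ + w v₅)) 0ℚ 0ℚ
          ≡⟨ cong₂ (λ x y → quad (ite c₂ x) (ite c₃ y) 0ℚ 0ℚ) w′-v₂ w′-v₃ ⟨
        quad (ite c₂ (w′ v₂)) (ite c₃ (w′ v₃)) 0ℚ 0ℚ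
          ≡⟨ weightOn-setInner s c₂ c₃ false false w′ ⟨
        weightOn w′ (toG′ s) inner ∎

  G′≼G : w v₃ ≤ w v₂ → ∀ s → Independent a (lookup U′) s →
         Σ (Fin n → Bool) λ t → Independent a (lookup fullSet) t × weight w′ s ≤ weight w t
  G′≼G w₃≤w₂ s I =
    toG true s , toG-independent true id I ,
    weight-≤-of-local inner-unique (setInner-outer s _ _ _ _) (λ i i∉inner → sym (w′-outer i i∉inner)) local
    where
      open Data.Rational.Properties.≤-Reasoning
      p q : Bool
      p = s v₁
      q = s v₄
      c₂ c₃ : Bool
      c₂ = pickFirst true p q
      c₃ = pickSecond true p q
      s₅ : s v₅ ≡ false
      s₅ = Independent-absent I v₅ (lookup-∖ˡ-∈ fullSet {xs = v₅ ∷ v₆ ∷ []} (here refl))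
      s₆ : s v₆ ≡ false
      s₆ = Independent-absent I v₆ (lookup-∖ˡ-∈ fullSet {xs = v₅ ∷ v₆ ∷ []} (there (here refl)))
      local : weightOn w′ s inner ≤ weightOn w (toG true s) inner
      local = begin
        weightOn w′ s inner
          ≡⟨ weightOn-inner w′ s ⟩
        quad (ite (s v₂) (w′ v₂)) (ite (s v₃) (w′ v₃)) (ite (s v₅) (w′ v₅)) (ite (s v₆) (w′ v₆))
          ≡⟨ cong₂ (λ b c → quad (ite (s v₂) (w′ v₂)) (ite (s v₃) (w′ v₃)) (ite b (w′ v₅)) (ite c (w′ v₆))) s₅ s₆ ⟩
        quad (ite (s v₂) (w′ v₂)) (ite (s v₃) (w′ v₃)) 0ℚ 0ℚ
          ≡⟨ cong₂ (λ x y → quad (ite (s v₂) x) (ite (s v₃) y) 0ℚ 0ℚ) w′-v₂ w′-v₃ ⟩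
        quad (ite (s v₂) (w v₂ + w v₆)) (ite (s v₃) (w v₃ + w v₅)) 0ℚ 0ℚ
          ≤⟨ two-paths-≤ (path-bound true p q _ _ (nonneg-+ v₂ v₆) (nonneg-+ v₃ v₅) (+-mono-≤ w₃≤w₂ w₅≤w₆)
                                     (proj₁ (cycle-paths id I))) ≤-refl ⟩
        quad (ite c₂ (w v₂ + w v₆)) (ite c₃ (w v₃ + w v₅)) 0ℚ 0ℚ
          ≡⟨ merge-paths c₂ c₃ (w v₂) (w v₃) (w v₅) (w v₆) ⟨
        quad (ite c₂ (w v₂)) (ite c₃ (w v₃)) (ite c₃ (w v₅)) (ite c₂ (w v₆))
          ≡⟨ weightOn-setInner s c₂ c₃ c₃ c₂ w ⟨
        weightOn w (toG true s) inner ∎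

  G≼G″ : w v₂ ≤ w v₃ → ∀ d → Prefers d (w v₂ + w v₆) (w v₃ + w v₅) → ∀ s → Independent a (lookup fullSet) s →
         Σ (Fin n → Bool) λ t → Independent a″ (lookup U″) t × weight w s ≤ weight w″ t
  G≼G″ w₂≤w₃ d prefers s I =
    toG″ d s , toG″-independent d I , weight-≤-of-local inner-unique (setInner-outer s _ _ _ _) w″-outer local
    where
      open Data.Rational.Properties.≤-Reasoning
      p q : Bool
      p = s v₁
      q = s v₄
      c₂ c₃ c₅ : Bool
      c₂ = pickFirst d p q
      c₃ = pickSecond d p q
      c₅ = not p ∧ not q
      local : weightOn w s inner ≤ weightOn w″ (toG″ d s) inner
      local = begin
        weightOn w s inner
          ≡⟨ weightOn-inner w s ⟩
        quad (ite (s v₂) (w v₂)) (ite (s v₃) (w v₃)) (ite (s v₅) (w v₅)) (ite (s v₆) (w v₆))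
          ≤⟨ two-paths-≤ (path-bound false p q _ _ (w-nonneg v₂) (w-nonneg v₃) w₂≤w₃ (proj₁ (cycle-paths id I)))
                         (path-bound true p q _ _ (w-nonneg v₆) (w-nonneg v₅) w₅≤w₆ (proj₂ (cycle-paths id I))) ⟩
        quad (ite (pickFirst false p q) (w v₂)) (ite (pickSecond false p q) (w v₃))
             (ite (pickSecond true p q) (w v₅)) (ite (pickFirst true p q) (w v₆))
          ≡⟨ merge-paths-with-slack d p q prefers ⟩
        quad (ite c₂ (w v₂ + w v₆)) (ite c₃ (w v₃ + w v₅)) (ite c₅ slack) 0ℚ
          ≡⟨ cong₂ (λ x y → quad (ite c₂ x) (ite c₃ y) (ite c₅ slack) 0ℚ) w″-v₂ w″-v₃ ⟨
        quad (ite c₂ (w″ v₂)) (ite c₃ (w″ v₃)) (ite c₅ slack) 0ℚ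
          ≡⟨ cong (λ z → quad (ite c₂ (w″ v₂)) (ite c₃ (w″ v₃)) (ite c₅ z) 0ℚ) w″-v₅ ⟨
        quad (ite c₂ (w″ v₂)) (ite c₃ (w″ v₃)) (ite c₅ (w″ v₅)) 0ℚ
          ≡⟨ weightOn-setInner s c₂ c₃ c₅ false w″ ⟨
        weightOn w″ (toG″ d s) inner ∎

  G″≼G : w v₂ ≤ w v₃ → ∀ d → Prefers d (w v₂ + w v₆) (w v₃ + w v₅) → ∀ s → Independent a″ (lookup U″) s →
         Σ (Fin n → Bool) λ t → Independent a (lookup fullSet) t × weight w″ s ≤ weight w t
  G″≼G w₂≤w₃ d prefers s I =
    toG false s , toG-independent false (addEdge-⊇ a v₁ v₅) I ,
    weight-≤-of-local inner-unique (setInner-outer s _ _ _ _) (λ i i∉inner → sym (w″-outer i i∉inner)) local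
    where
      open Data.Rational.Properties.≤-Reasoning
      p q : Bool
      p = s v₁
      q = s v₄
      c₂ c₃ c₅ : Bool
      c₂ = pickFirst d p q
      c₃ = pickSecond d p q
      c₅ = not p ∧ not q
      paths : PathIndependent p (s v₂) (s v₃) q × PathIndependent p (s v₆) (s v₅) q
      paths = cycle-paths (addEdge-⊇ a v₁ v₅) I
      s₆ : s v₆ ≡ false
      s₆ = Independent-absent I v₆ (lookup-∖ˡ-∈ fullSet {xs = v₆ ∷ []} (here refl))
      s₁₅ : s v₁ ∧ s v₅ ≡ false
      s₁₅ = I .no-edge v₁ v₅ (addEdge-new a v₁ v₅)
      s₅₄ : s v₅ ∧ s v₄ ≡ false
      s₅₄ = proj₂ (proj₂ (proj₂ paths))
      local : weightOn w″ s inner ≤ weightOn w (toG false s) inner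
      local = begin
        weightOn w″ s inner
          ≡⟨ weightOn-inner w″ s ⟩
        quad (ite (s v₂) (w″ v₂)) (ite (s v₃) (w″ v₃)) (ite (s v₅) (w″ v₅)) (ite (s v₆) (w″ v₆))
          ≡⟨ cong (λ b → quad (ite (s v₂) (w″ v₂)) (ite (s v₃) (w″ v₃)) (ite (s v₅) (w″ v₅)) (ite b (w″ v₆))) s₆ ⟩
        quad (ite (s v₂) (w″ v₂)) (ite (s v₃) (w″ v₃)) (ite (s v₅) (w″ v₅)) 0ℚ
          ≡⟨ cong₂ (λ x y → quad (ite (s v₂) x) (ite (s v₃) y) (ite (s v₅) (w″ v₅)) 0ℚ) w″-v₂ w″-v₃ ⟩
        quad (ite (s v₂) (w v₂ + w v₆)) (ite (s v₃) (w v₃ + w v₅)) (ite (s v₅) (w″ v₅)) 0ℚ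
          ≡⟨ cong (λ z → quad (ite (s v₂) (w v₂ + w v₆)) (ite (s v₃) (w v₃ + w v₅)) (ite (s v₅) z) 0ℚ) w″-v₅ ⟩
        quad (ite (s v₂) (w v₂ + w v₆)) (ite (s v₃) (w v₃ + w v₅)) (ite (s v₅) slack) 0ℚ
          ≤⟨ two-paths-≤ (path-bound d p q _ _ (nonneg-+ v₂ v₆) (nonneg-+ v₃ v₅) prefers (proj₁ paths))
                         (+-monoʳ-≤ 0ℚ (lone-bound p q (s v₅) (slack-nonneg w₂≤w₃ w₅≤w₆) s₁₅ s₅₄)) ⟩
        quad (ite c₂ (w v₂ + w v₆)) (ite c₃ (w v₃ + w v₅)) (ite c₅ slack) 0ℚ
          ≡⟨ merge-paths-with-slack d p q prefers ⟨
        quad (ite (pickFirst false p q) (w v₂)) (ite (pickSecond false p q) (w v₃))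
             (ite (pickSecond true p q) (w v₅)) (ite (pickFirst true p q) (w v₆))
          ≡⟨ weightOn-setInner s _ _ _ _ w ⟨
        weightOn w (toG false s) inner ∎

  reduction₁ : w v₃ ≤ w v₂ → αOn a w fullSet ≡ αOn a w′ U′
  reduction₁ w₃≤w₂ = ≤-antisym (αOn-mono fullSet U′ (G≼G′ w₃≤w₂)) (αOn-mono U′ fullSet (G′≼G w₃≤w₂))

  reduction₂ : w v₂ < w v₃ → αOn a w fullSet ≡ αOn a″ w″ U″
  reduction₂ w₂<w₃ with d , prefers ← prefers? (w v₂ + w v₆) (w v₃ + w v₅) =
    ≤-antisym (αOn-mono fullSet U″ (G≼G″ (<⇒≤ w₂<w₃) d prefers))
              (αOn-mono U″ fullSet (G″≼G (<⇒≤ w₂<w₃) d prefers))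

lemma8 : ∀ {n} (G : SimpleGraph n) (w : Fin n → ℚ)
           (v₁ v₂ v₃ v₄ v₅ v₆ : Fin n) →
           (∀ i → 0ℚ < w i) →
           Unique (v₁ ∷ v₂ ∷ v₃ ∷ v₄ ∷ v₅ ∷ v₆ ∷ []) →
           adj G v₁ v₂ ≡ true → adj G v₂ v₃ ≡ true → adj G v₃ v₄ ≡ true →
           adj G v₄ v₅ ≡ true → adj G v₅ v₆ ≡ true → adj G v₆ v₁ ≡ true →
           degree (adj G) v₂ ≡ 2 → degree (adj G) v₃ ≡ 2 →
           degree (adj G) v₅ ≡ 2 → degree (adj G) v₆ ≡ 2 →
           w v₂ ⊔ w v₆ ≤ w v₁ → w v₃ ⊔ w v₅ ≤ w v₄ → w v₅ ≤ w v₆ →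
           (w v₃ ≤ w v₂ →
             α G w ≡ αOn (adj G)
                        (setW (setW w v₂ (w v₂ + w v₆)) v₃ (w v₃ + w v₅))
                        (fullSet ∖ˡ (v₅ ∷ v₆ ∷ [])))
           × (w v₂ < w v₃ →
             α G w ≡ αOn (addEdge (adj G) v₁ v₅)
                        (setW (setW (setW w v₂ (w v₂ + w v₆)) v₃ (w v₃ + w v₅))
                              v₅ (w v₆ + w v₃ - ((w v₂ + w v₆) ⊔ (w v₃ + w v₅))))
                        (fullSet ∖ˡ (v₆ ∷ [])))
lemma8 G w v₁ v₂ v₃ v₄ v₅ v₆ w-pos
  ((v₁≢v₂ ∷ v₁≢v₃ ∷ _ ∷ v₁≢v₅ ∷ v₁≢v₆ ∷ []) ∷ (v₂≢v₃ ∷ v₂≢v₄ ∷ v₂≢v₅ ∷ v₂≢v₆ ∷ []) ∷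
   (v₃≢v₄ ∷ v₃≢v₅ ∷ v₃≢v₆ ∷ []) ∷ (v₄≢v₅ ∷ v₄≢v₆ ∷ []) ∷ (v₅≢v₆ ∷ []) ∷ [] ∷ [])
  e₁₂ e₂₃ e₃₄ e₄₅ e₅₆ e₆₁ deg₂ deg₃ deg₅ deg₆ _ _ w₅≤w₆ = reduction₁ , reduction₂
  where
    open SixCycle (adj G) (adj-sym G) v₁ v₂ v₃ v₄ v₅ v₆
      v₁≢v₂ v₁≢v₃ v₁≢v₅ v₁≢v₆ v₂≢v₃ v₂≢v₄ v₂≢v₅ v₂≢v₆ v₃≢v₄ v₃≢v₅ v₃≢v₆ v₄≢v₅ v₄≢v₆ v₅≢v₆
      e₁₂ e₂₃ e₃₄ e₄₅ e₅₆ e₆₁ deg₂ deg₃ deg₅ deg₆ w (λ i → <⇒≤ (w-pos i)) w₅≤w₆
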